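{- Let $p\ge 11$ be a prime. For $1\le \beta\le p-1$ let $\beta^*$ be the unique integer with $1\le\beta^*\le p-1$ and $\beta\beta^*\equiv1\pmod p$. Let $\mathcal{B}_-(p)$ be the set of integers $\beta$ with $1\le \beta\le (p-3)/2$, $p\le \beta+2\beta^*+1$ and $\beta>\beta^*$, let $\mathcal{B}_+(p)$ be the set of integers $\beta$ with $1\le \beta\le (p-3)/2$, $\beta+\beta^*\ge p$ and $\beta^*\le 2\beta$, and put $\mathcal{B}(p)=\mathcal{B}_-(p)\cup\mathcal{B}_+(p)$. Then $\mathcal{B}(p)$ is non-empty and $\max\mathcal{B}(p)=(p-3)/2$. -}

module Defs where

open import Data.Nat using (ℕ; _+_; _*_; _∸_; _≤_; _<_; _/_; _%_)
open import Data.Product using (_×_; ∃-syntax)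
open import Data.Sum using (_⊎_)
open import Relation.Binary.PropositionalEquality using (_≡_)

-- b is the inverse β* of β modulo p, normalised to 1 ≤ b ≤ p - 1.
-- ββ* ≡ 1 (mod p) is written β * b = 1 + k * p for some k.
-- (For p prime and 1 ≤ β ≤ p-1 such b exists and is unique.)
IsInv : (p β b : ℕ) → Set
IsInv p β b = 1 ≤ b × b ≤ p ∸ 1 × ∃[ k ] (β * b ≡ 1 + k * p)

-- upper bound (p-3)/2 (p odd, so exact)
half : ℕ → ℕ
half p = (p ∸ 3) / 2

InBminus : ℕ → ℕ → Set
InBminus p β = 1 ≤ β × β ≤ half p ×
  ∃[ b ] (IsInv p β b × p ≤ β + 2 * b + 1 × b < β)

InBplus : ℕ → ℕ → Set
InBplus p β = 1 ≤ β × β ≤ half p ×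
  ∃[ b ] (IsInv p β b × p ≤ β + b × b ≤ 2 * β)

InB : ℕ → ℕ → Set
InB p β = InBminus p β ⊎ InBplus p β

{-# OPTIONS --safe #-}
module Submission where

-- A prime p ≥ 5 is ±1 mod 6, and in both cases β = (p-3)/2 has an explicit inverse.
-- For p = 6m+1 one has β* = 4m, since (3m-1)·4m = 1 + (2m-1)p, and β ∈ B₊(p) once m ≥ 2;
-- for p = 6m+5 one has β* = 2m+1, since (3m+1)(2m+1) = 1 + mp, and β ∈ B₋(p) once m ≥ 1.
-- Below, p = 13 + 6u (so m = u + 2) and p = 11 + 6u (so m = u + 1).

open import Defs
open import Data.Nat using (ℕ; suc; _+_; _*_; _∸_; _≤_; _<_; _/_; _%_; _≤?_; z≤n; s≤s; NonTrivial)
open import Data.Nat.DivMod using (m≡m%n+[m/n]*n; m%n<n; m*n/n≡m)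
open import Data.Nat.Divisibility using (_∣_; _∤_; divides; ∣-trans; ∣m∣n⇒∣m+n; n∣m*n)
open import Data.Nat.Primality using (Prime; composite; prime⇒¬composite)
open import Data.Nat.Properties using (≤-trans; ≤-refl; m≤m+n)
open import Data.Nat.Tactic.RingSolver using (solve)
open import Data.List using (_∷_; [])
open import Data.Product using (_×_; ∃-syntax; _,_)
open import Data.Sum using (_⊎_; inj₁; inj₂)
open import Relation.Binary.PropositionalEquality using (_≡_; refl; sym; subst)
open import Relation.Nullary using (contradiction)
open import Relation.Nullary.Decidable using (from-no)

prime⇒∤ : ∀ {p} → Prime p → ∀ d .{{_ : NonTrivial d}} → d < p → d ∤ p
prime⇒∤ pr d d<p d∣p = prime⇒¬composite pr (composite d<p d∣p)

∣-residue[mod6] : ∀ {d r} q → d ∣ r → d ∣ 6 → d ∣ r + q * 6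
∣-residue[mod6] q d∣r d∣6 = ∣m∣n⇒∣m+n d∣r (∣-trans d∣6 (n∣m*n q))

prime≥5⇒≡±1[mod6] : ∀ {p} → Prime p → 5 ≤ p →
  (∃[ m ] p ≡ 1 + m * 6) ⊎ (∃[ m ] p ≡ 5 + m * 6)
prime≥5⇒≡±1[mod6] {p} pr 5≤p = classify (p % 6) (m%n<n p 6) (m≡m%n+[m/n]*n p 6)
  where
  2<p : 2 < p
  2<p = ≤-trans (m≤m+n 3 2) 5≤p
  3<p : 3 < p
  3<p = ≤-trans (m≤m+n 4 1) 5≤p
  divisor : ∀ {d r} → d ∣ r → d ∣ 6 → p ≡ r + p / 6 * 6 → d ∣ p
  divisor d∣r d∣6 p≡ = subst (_ ∣_) (sym p≡) (∣-residue[mod6] (p / 6) d∣r d∣6)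
  classify : ∀ r → r < 6 → p ≡ r + p / 6 * 6 → (∃[ m ] p ≡ 1 + m * 6) ⊎ (∃[ m ] p ≡ 5 + m * 6)
  classify 0 _ p≡ = contradiction (divisor (divides 0 refl) (divides 3 refl) p≡) (prime⇒∤ pr 2 2<p)
  classify 1 _ p≡ = inj₁ (p / 6 , p≡)
  classify 2 _ p≡ = contradiction (divisor (divides 1 refl) (divides 3 refl) p≡) (prime⇒∤ pr 2 2<p)
  classify 3 _ p≡ = contradiction (divisor (divides 1 refl) (divides 2 refl) p≡) (prime⇒∤ pr 3 3<p)
  classify 4 _ p≡ = contradiction (divisor (divides 2 refl) (divides 3 refl) p≡) (prime⇒∤ pr 2 2<p)
  classify 5 _ p≡ = inj₂ (p / 6 , p≡)
  classify (suc (suc (suc (suc (suc (suc _)))))) (s≤s (s≤s (s≤s (s≤s (s≤s (s≤s ())))))) _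

m+k≡n⇒m≤n : ∀ {m n} k → m + k ≡ n → m ≤ n
m+k≡n⇒m≤n {m} k m+k≡n = subst (m ≤_) m+k≡n (m≤m+n m k)

p≡3+k*2⇒half[p]≡k : ∀ p k → p ≡ 3 + k * 2 → half p ≡ k
p≡3+k*2⇒half[p]≡k .(3 + k * 2) k refl = m*n/n≡m k 2

half∈B₊[13+u*6] : ∀ u → InBplus (13 + u * 6) (half (13 + u * 6))
half∈B₊[13+u*6] u rewrite p≡3+k*2⇒half[p]≡k (13 + u * 6) (5 + u * 3) (solve (u ∷ [])) =
  s≤s z≤n , ≤-refl , 8 + u * 4 , inverse ,
  m+k≡n⇒m≤n u (solve (u ∷ [])) , m+k≡n⇒m≤n (2 + u * 2) (solve (u ∷ []))
  where
  inverse : IsInv (13 + u * 6) (5 + u * 3) (8 + u * 4)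
  inverse = s≤s z≤n , m+k≡n⇒m≤n {n = 12 + u * 6} (4 + u * 2) (solve (u ∷ [])) , 3 + u * 2 , solve (u ∷ [])

half∈B₋[11+u*6] : ∀ u → InBminus (11 + u * 6) (half (11 + u * 6))
half∈B₋[11+u*6] u rewrite p≡3+k*2⇒half[p]≡k (11 + u * 6) (4 + u * 3) (solve (u ∷ [])) =
  s≤s z≤n , ≤-refl , 3 + u * 2 , inverse ,
  m+k≡n⇒m≤n u (solve (u ∷ [])) , m+k≡n⇒m≤n u (solve (u ∷ []))
  where
  inverse : IsInv (11 + u * 6) (4 + u * 3) (3 + u * 2)
  inverse = s≤s z≤n , m+k≡n⇒m≤n {n = 10 + u * 6} (7 + u * 4) (solve (u ∷ [])) , 1 + u , solve (u ∷ [])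

half∈B : ∀ {p} → Prime p → 11 ≤ p → InB p (half p)
half∈B pr 11≤p with prime≥5⇒≡±1[mod6] pr (≤-trans (m≤m+n 5 6) 11≤p)
... | inj₁ (suc (suc u) , refl) = inj₂ (half∈B₊[13+u*6] u)
... | inj₂ (suc u , refl)       = inj₁ (half∈B₋[11+u*6] u)
... | inj₁ (0 , refl)           = contradiction 11≤p (from-no (11 ≤? 1))
... | inj₁ (1 , refl)           = contradiction 11≤p (from-no (11 ≤? 7))
... | inj₂ (0 , refl)           = contradiction 11≤p (from-no (11 ≤? 5))

InB⇒≤half : ∀ {p β} → InB p β → β ≤ half p
InB⇒≤half (inj₁ (_ , β≤half , _)) = β≤half
InB⇒≤half (inj₂ (_ , β≤half , _)) = β≤half

proposition1 : (p : ℕ) → Prime p → 11 ≤ p →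
    (∃[ β ] InB p β) × InB p ((p ∸ 3) / 2) × (∀ β → InB p β → β ≤ (p ∸ 3) / 2)
proposition1 p pr 11≤p = (half p , half∈B pr 11≤p) , half∈B pr 11≤p , λ _ → InB⇒≤half
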